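{- Let $n_1,n_2\ge 0$ be integers and $n=n_1+n_2$. Let $S=(S_1,\dots,S_{2n_1})$ be a sequence of letters from $\{1,\bar{1}\}$ containing exactly $n_1$ copies of $1$ and $n_1$ copies of $\bar{1}$, and let $1\le \tilde P_1<\tilde P_2<\dots<\tilde P_{2n_1}\le 2n$ be integers. Define $T_i=1$ if $S_i=1$ and $T_i=-1$ if $S_i=\bar{1}$; $P_i=\tilde P_i-i$; and $H_i=\max\{ -\sum_{k=1}^i T_k,\,0\}$ for $i=1,\dots,2n_1$. Then there is a bijection between the set of complete Gessel words $w$ of length $2n$ such that, for each $i$, the letter of $w$ at position $\tilde P_i$ is $S_i$ and all other letters of $w$ lie in $\{2,\bar{2}\}$, and the set of $(P,H)$-Dyck paths of length $2n_2$, where $P=(P_1,\dots,P_{2n_1})$ and $H=(H_1,\dots,H_{2n_1})$.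
   Context: Words are finite sequences over the alphabet $\{1,2,\bar{1},\bar{2}\}$. For a word $x$ and letter $\alpha$, $N_\alpha(x)$ is the number of occurrences of $\alpha$ in $x$. A word $w$ is a Gessel word if every prefix $x$ of $w$ satisfies $N_2(x)-N_{\bar{2}}(x)\ge 0$ and $N_2(x)+N_1(x)-N_{\bar{2}}(x)-N_{\bar{1}}(x)\ge 0$; it is complete if moreover $N_1(w)=N_{\bar{1}}(w)$ and $N_2(w)=N_{\bar{2}}(w)$. A Dyck path of length $2m$ is a lattice path from $(0,0)$ to $(2m,0)$ with steps $(1,1)$ and $(1,-1)$ that never goes below the $x$-axis. Given a nondecreasing list $P=(P_1,\dots,P_{M})$ of nonnegative integers and a list $H=(H_1,\dots,H_M)$ of nonnegative integers, a $(P,H)$-Dyck path is a Dyck path such that for each $i=1,\dots,M-1$ and each integer $x$ with $P_i\le x\le P_{i+1}$, the ordinate of the path at abscissa $x$ is at least $H_i$. -}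

module Defs where

open import Level using (0ℓ)
open import Data.Nat using (ℕ; zero; suc; _+_; _*_; _∸_; _≤_)
open import Data.Integer as ℤ using (ℤ; +_; -_; _⊔_; _-_)
open import Data.Fin using (Fin; toℕ)
open import Data.List using (List; []; _∷_; _++_; take; tabulate; map; foldr; length)
open import Data.List.Relation.Unary.All using (All)
open import Data.Maybe using (Maybe; just; nothing)
open import Data.Product using (Σ; _×_; proj₁)
open import Data.Sum using (_⊎_)
open import Relation.Binary.PropositionalEquality using (_≡_; _≢_)
import Relation.Binary.PropositionalEquality as Eq
open import Relation.Binary.Bundles using (Setoid)
import Relation.Binary.Construct.On as On

data Letter : Set where
  one two one̅ two̅ : Letter

N : Letter → List Letter → ℕ
N α [] = 0
N one (one ∷ xs) = suc (N one xs)
N two (two ∷ xs) = suc (N two xs)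
N one̅ (one̅ ∷ xs) = suc (N one̅ xs)
N two̅ (two̅ ∷ xs) = suc (N two̅ xs)
N α (_ ∷ xs) = N α xs

IsGessel : List Letter → Set
IsGessel w = ∀ (x y : List Letter) → x ++ y ≡ w →
  (ℤ.0ℤ ℤ.≤ (+ N two x) - (+ N two̅ x)) ×
  (ℤ.0ℤ ℤ.≤ ((+ N two x) ℤ.+ (+ N one x)) - ((+ N two̅ x) ℤ.+ (+ N one̅ x)))

IsCompleteGessel : List Letter → Set
IsCompleteGessel w = IsGessel w × (N one w ≡ N one̅ w) × (N two w ≡ N two̅ w)

-- the letter at 1-based position p of a word (nothing if out of range)
_at_ : List Letter → ℕ → Maybe Letter
[] at _ = nothing
(x ∷ xs) at zero = nothing
(x ∷ xs) at suc zero = just x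
(x ∷ xs) at suc (suc p) = xs at suc p

sumℤ : List ℤ → ℤ
sumℤ = foldr ℤ._+_ ℤ.0ℤ

-- Dyck paths: steps (1,1) = U and (1,-1) = D
data Step : Set where
  U D : Step

stepℤ : Step → ℤ
stepℤ U = + 1
stepℤ D = - (+ 1)

height : List Step → ℤ
height p = sumℤ (map stepℤ p)

ordinate : List Step → ℕ → ℤ
ordinate p x = height (take x p)

IsDyck : ℕ → List Step → Set
IsDyck m p = (length p ≡ 2 * m) ×
             (∀ (x y : List Step) → x ++ y ≡ p → ℤ.0ℤ ℤ.≤ height x) ×
             (height p ≡ ℤ.0ℤ)

-- (P,H)-Dyck path of length 2m, with P, H indexed by Fin M (index i ↔ paper index i+1)
IsPHDyck : ℕ → (M : ℕ) → (Fin M → ℕ) → (Fin M → ℤ) → List Step → Set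
IsPHDyck m M P H p = IsDyck m p ×
  (∀ (i j : Fin M) → toℕ j ≡ suc (toℕ i) →
     ∀ (x : ℕ) → P i ≤ x → x ≤ P j → H i ℤ.≤ ordinate p x)

-- Data of the lemma (S, P̃ indexed by Fin (2 n₁), index i ↔ paper index i+1)
T : Letter → ℤ
T one = + 1
T _ = - (+ 1)

Pof : ∀ {M} → (Fin M → ℕ) → Fin M → ℕ
Pof P̃ i = P̃ i ∸ suc (toℕ i)

Hof : ∀ {M} → (Fin M → Letter) → Fin M → ℤ
Hof S i = (- sumℤ (map T (take (suc (toℕ i)) (tabulate S)))) ⊔ ℤ.0ℤ

IsConstrainedWord : (n : ℕ) → ∀ {M} → (Fin M → Letter) → (Fin M → ℕ) → List Letter → Set
IsConstrainedWord n S P̃ w =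
  (length w ≡ 2 * n) × IsCompleteGessel w ×
  (∀ i → w at (P̃ i) ≡ just (S i)) ×
  (∀ (q : ℕ) → 1 ≤ q → q ≤ 2 * n → (∀ i → q ≢ P̃ i) →
     (w at q ≡ just two) ⊎ (w at q ≡ just two̅))

-- the set {a : A | Q a} as a setoid: elements equal iff underlying objects equal
SubSetoid : (A : Set) → (A → Set) → Setoid 0ℓ 0ℓ
SubSetoid A Q = On.setoid {B = Σ A Q} (Eq.setoid A) proj₁

module Submission where

-- A constrained word w has its 1-letters at the prescribed
-- positions P̃ᵢ, so it is determined by the sequence of its 2-letters; read
-- as steps (2 ↦ up, 2̄ ↦ down) these form a lattice path of length 2n₂, and
-- the bijection is  w ↦ twos w,  with inverse "fill the free positions of the
-- template with the steps of the path".

open import Defs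
open import Data.Nat using (ℕ; _+_; _*_; _≤_; _<_)
open import Data.Fin using (Fin)
import Data.Fin as Fin
open import Data.List using (List; tabulate)
open import Data.Sum using (_⊎_)
open import Relation.Binary.PropositionalEquality using (_≡_)
open import Function.Bundles using (Bijection)

open import Data.Nat using (zero; suc; _∸_; _≮_; z≤n; s≤s)
open import Data.Nat.Properties
open import Data.Integer as ℤ using (ℤ; +_; -_; _⊔_; 0ℤ)
import Data.Integer.Properties as ℤP
open import Data.Integer.Solver using (module +-*-Solver)
open import Data.Fin using (toℕ; fromℕ<) renaming (zero to fzero; suc to fsuc)
import Data.Fin.Properties as FinP
open import Data.List using ([]; _∷_; _++_; take; drop; length; map)
open import Data.List.Properties
  using (take++drop≡id; length-take; take-all; length-tabulate; length-++; take-suc-tabulate; ++-identityʳ)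
open import Data.List.Relation.Unary.All using (All; []; _∷_)
open import Data.List.Relation.Unary.All.Properties using (tabulate⁺)
open import Data.Maybe using (Maybe; just; nothing)
open import Data.Maybe.Properties using (just-injective)
open import Data.Product using (Σ; _×_; _,_; proj₁; proj₂; ∃)
open import Data.Sum using (inj₁; inj₂)
open import Data.Unit using (⊤; tt)
open import Data.Empty using (⊥-elim)
open import Relation.Nullary using (yes; no)
open import Relation.Binary.Definitions using (tri<; tri≈; tri>)
open import Relation.Binary.PropositionalEquality
  using (_≢_; refl; sym; trans; cong; cong₂; subst; subst₂; module ≡-Reasoning)

IsOne : Letter → Set
IsOne a = (a ≡ one) ⊎ (a ≡ one̅)

IsTwo : Letter → Set
IsTwo a = (a ≡ two) ⊎ (a ≡ two̅)

twos : List Letter → List Step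
twos [] = []
twos (one ∷ w) = twos w
twos (one̅ ∷ w) = twos w
twos (two ∷ w) = U ∷ twos w
twos (two̅ ∷ w) = D ∷ twos w

ones : List Letter → List Letter
ones [] = []
ones (one ∷ w) = one ∷ ones w
ones (one̅ ∷ w) = one̅ ∷ ones w
ones (two ∷ w) = ones w
ones (two̅ ∷ w) = ones w

sumT : List Letter → ℤ
sumT x = sumℤ (map T x)

twos-++ : ∀ a b → twos (a ++ b) ≡ twos a ++ twos b
twos-++ [] b = refl
twos-++ (one ∷ a) b = twos-++ a b
twos-++ (one̅ ∷ a) b = twos-++ a b
twos-++ (two ∷ a) b = cong (U ∷_) (twos-++ a b)
twos-++ (two̅ ∷ a) b = cong (D ∷_) (twos-++ a b)

ones-of-ones : ∀ {x} → All IsOne x → ones x ≡ x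
ones-of-ones [] = refl
ones-of-ones (inj₁ refl ∷ h) = cong (one ∷_) (ones-of-ones h)
ones-of-ones (inj₂ refl ∷ h) = cong (one̅ ∷_) (ones-of-ones h)

length-split : ∀ w → length w ≡ length (ones w) + length (twos w)
length-split [] = refl
length-split (one ∷ w) = cong suc (length-split w)
length-split (one̅ ∷ w) = cong suc (length-split w)
length-split (two ∷ w) = trans (cong suc (length-split w)) (sym (+-suc _ _))
length-split (two̅ ∷ w) = trans (cong suc (length-split w)) (sym (+-suc _ _))

twos-one : ∀ {a} w → IsOne a → twos (a ∷ w) ≡ twos w
twos-one w (inj₁ refl) = refl
twos-one w (inj₂ refl) = refl

ones-one : ∀ {a} w → IsOne a → ones (a ∷ w) ≡ a ∷ ones w
ones-one w (inj₁ refl) = refl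
ones-one w (inj₂ refl) = refl

ones-two : ∀ {a} w → IsTwo a → ones (a ∷ w) ≡ ones w
ones-two w (inj₁ refl) = refl
ones-two w (inj₂ refl) = refl

take-length-++ : ∀ {A : Set} (xs ys : List A) → take (length xs) (xs ++ ys) ≡ xs
take-length-++ [] ys = refl
take-length-++ (x ∷ xs) ys = cong (x ∷_) (take-length-++ xs ys)

prefix-as-take : ∀ {A : Set} (x y w : List A) → x ++ y ≡ w → x ≡ take (length x) w
prefix-as-take x y w refl = sym (take-length-++ x y)

twos-take : ∀ q w → twos (take q w) ≡ take (length (twos (take q w))) (twos w)
twos-take q w = sym (begin
    take (length (twos (take q w))) (twos w)
  ≡⟨ cong (λ z → take (length (twos (take q w))) (twos z)) (sym (take++drop≡id q w)) ⟩
    take (length (twos (take q w))) (twos (take q w ++ drop q w))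
  ≡⟨ cong (take (length (twos (take q w)))) (twos-++ (take q w) (drop q w)) ⟩
    take (length (twos (take q w))) (twos (take q w) ++ twos (drop q w))
  ≡⟨ take-length-++ (twos (take q w)) (twos (drop q w)) ⟩
    twos (take q w) ∎)
  where open ≡-Reasoning

take-twos : ∀ k w → ∃ λ q → take k (twos w) ≡ twos (take q w)
take-twos zero w = 0 , refl
take-twos (suc k) [] = 0 , refl
take-twos (suc k) (one ∷ w) with take-twos (suc k) w
... | q , e = suc q , e
take-twos (suc k) (one̅ ∷ w) with take-twos (suc k) w
... | q , e = suc q , e
take-twos (suc k) (two ∷ w) with take-twos k w
... | q , e = suc q , cong (U ∷_) e
take-twos (suc k) (two̅ ∷ w) with take-twos k w
... | q , e = suc q , cong (D ∷_) e

open +-*-Solver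

suc-minus : ∀ a b → (+ suc a) ℤ.- (+ b) ≡ + 1 ℤ.+ ((+ a) ℤ.- (+ b))
suc-minus a b = solve 2 (λ x y → (con (+ 1) :+ x) :- y := con (+ 1) :+ (x :- y)) refl (+ a) (+ b)

minus-suc : ∀ a b → (+ a) ℤ.- (+ suc b) ≡ - (+ 1) ℤ.+ ((+ a) ℤ.- (+ b))
minus-suc a b = solve 2 (λ x y → x :- (con (+ 1) :+ y) := :- con (+ 1) :+ (x :- y)) refl (+ a) (+ b)

height-twos : ∀ x → (+ N two x) ℤ.- (+ N two̅ x) ≡ height (twos x)
height-twos [] = refl
height-twos (one ∷ x) = height-twos x
height-twos (one̅ ∷ x) = height-twos x
height-twos (two ∷ x) = trans (suc-minus (N two x) (N two̅ x)) (cong (ℤ._+_ (+ 1)) (height-twos x))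
height-twos (two̅ ∷ x) = trans (minus-suc (N two x) (N two̅ x)) (cong (ℤ._+_ (- (+ 1))) (height-twos x))

sumT-ones : ∀ x → (+ N one x) ℤ.- (+ N one̅ x) ≡ sumT (ones x)
sumT-ones [] = refl
sumT-ones (one ∷ x) = trans (suc-minus (N one x) (N one̅ x)) (cong (ℤ._+_ (+ 1)) (sumT-ones x))
sumT-ones (one̅ ∷ x) = trans (minus-suc (N one x) (N one̅ x)) (cong (ℤ._+_ (- (+ 1))) (sumT-ones x))
sumT-ones (two ∷ x) = sumT-ones x
sumT-ones (two̅ ∷ x) = sumT-ones x

counts-equal : ∀ a b → (+ a) ℤ.- (+ b) ≡ 0ℤ → a ≡ b
counts-equal a b e = ℤP.+-injective (ℤP.i-j≡0⇒i≡j (+ a) (+ b) e)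

-- max(−s, 0) ≤ h  iff  0 ≤ h and 0 ≤ h + s: the height bound H of a
-- (P,H)-Dyck path is exactly the second Gessel inequality.
floor-≤⇒ : ∀ h s → (- s) ⊔ 0ℤ ℤ.≤ h → (0ℤ ℤ.≤ h) × (0ℤ ℤ.≤ h ℤ.+ s)
floor-≤⇒ h s le =
  ℤP.i⊔j≤k⇒j≤k (- s) 0ℤ le ,
  subst (λ z → 0ℤ ℤ.≤ h ℤ.+ z) (ℤP.neg-involutive s) (ℤP.i≤j⇒0≤j-i (ℤP.i⊔j≤k⇒i≤k (- s) 0ℤ le))

⇒floor-≤ : ∀ h s → 0ℤ ℤ.≤ h → 0ℤ ℤ.≤ h ℤ.+ s → (- s) ⊔ 0ℤ ℤ.≤ h
⇒floor-≤ h s h≥0 h+s≥0 =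
  ℤP.⊔-lub (ℤP.0≤i-j⇒j≤i (subst (λ z → 0ℤ ℤ.≤ h ℤ.+ z) (sym (ℤP.neg-involutive s)) h+s≥0)) h≥0

-- The two Gessel inequalities on a prefix x, in split form: the path of its
-- 2-letters ends nonnegative, and stays so after adding the 1-letter count.
SplitGessel : List Letter → Set
SplitGessel x = (0ℤ ℤ.≤ height (twos x)) × (0ℤ ℤ.≤ height (twos x) ℤ.+ sumT (ones x))

second-quantity : ∀ x → ((+ N two x) ℤ.+ (+ N one x)) ℤ.- ((+ N two̅ x) ℤ.+ (+ N one̅ x))
                      ≡ height (twos x) ℤ.+ sumT (ones x)
second-quantity x =
  trans (solve 4 (λ a b c d → (a :+ b) :- (c :+ d) := (a :- c) :+ (b :- d)) refl
                 (+ N two x) (+ N one x) (+ N two̅ x) (+ N one̅ x))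
        (cong₂ ℤ._+_ (height-twos x) (sumT-ones x))

gessel⇒split : ∀ w → IsGessel w → ∀ q → SplitGessel (take q w)
gessel⇒split w g q with g (take q w) (drop q w) (take++drop≡id q w)
... | g₁ , g₂ = subst (0ℤ ℤ.≤_) (height-twos (take q w)) g₁ ,
                subst (0ℤ ℤ.≤_) (second-quantity (take q w)) g₂

split⇒gessel : ∀ w → (∀ q → q ≤ length w → SplitGessel (take q w)) → IsGessel w
split⇒gessel w h x y e rewrite prefix-as-take x y w e =
  subst (0ℤ ℤ.≤_) (sym (height-twos x′)) s₁ , subst (0ℤ ℤ.≤_) (sym (second-quantity x′)) s₂
  where
  x′ : List Letter
  x′ = take (length x) w
  x≤w : length x ≤ length w
  x≤w = subst (length x ≤_) (trans (sym (length-++ x)) (cong length e)) (m≤m+n (length x) (length y))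
  s₁ : 0ℤ ℤ.≤ height (twos x′)
  s₁ = proj₁ (h (length x) x≤w)
  s₂ : 0ℤ ℤ.≤ height (twos x′) ℤ.+ sumT (ones x′)
  s₂ = proj₂ (h (length x) x≤w)

NonNeg : List Step → Set
NonNeg p = ∀ (x y : List Step) → x ++ y ≡ p → 0ℤ ℤ.≤ height x

split⇒nonneg : ∀ w → (∀ q → SplitGessel (take q w)) → NonNeg (twos w)
split⇒nonneg w h x y e with take-twos (length x) w
... | q , eq = subst (0ℤ ℤ.≤_) (cong height (sym (trans (prefix-as-take x y (twos w) e) eq))) (proj₁ (h q))

nonneg-ordinate : ∀ p → NonNeg p → ∀ k → 0ℤ ℤ.≤ ordinate p k
nonneg-ordinate p h k = h (take k p) (drop k p) (take++drop≡id k p)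

Allowed : Maybe Letter → Letter → Set
Allowed (just a) x = x ≡ a
Allowed nothing x = IsTwo x

stepLetter : Step → Letter
stepLetter U = two
stepLetter D = two̅

at-zero : ∀ w {x} → w at zero ≢ just x
at-zero [] ()
at-zero (y ∷ w) ()

-- A template assigns to every position (counted from 1) either a prescribed
-- 1-letter or nothing (a free position, to be filled by a 2-letter).  The
-- functions below work on the window of positions q+1, q+2, ….
module Template (τ : ℕ → Maybe Letter) (prescribed-one : ∀ k a → τ k ≡ just a → IsOne a) where

  Fits : ℕ → List Letter → Set
  Fits q [] = ⊤
  Fits q (x ∷ xs) = Allowed (τ (suc q)) x × Fits (suc q) xs

  fill : ℕ → ℕ → List Step → List Letter
  fill zero q p = []
  fill (suc L) q p with τ (suc q)
  ... | just a = a ∷ fill L (suc q) p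
  fill (suc L) q [] | nothing = two ∷ fill L (suc q) []
  fill (suc L) q (s ∷ p) | nothing = stepLetter s ∷ fill L (suc q) p

  holes : ℕ → ℕ → ℕ
  holes zero q = 0
  holes (suc L) q with τ (suc q)
  ... | just _ = holes L (suc q)
  ... | nothing = suc (holes L (suc q))

  prescribed : ℕ → ℕ → List Letter
  prescribed zero q = []
  prescribed (suc L) q with τ (suc q)
  ... | just a = a ∷ prescribed L (suc q)
  ... | nothing = prescribed L (suc q)

  holes+prescribed : ∀ L q → holes L q + length (prescribed L q) ≡ L
  holes+prescribed zero q = refl
  holes+prescribed (suc L) q with τ (suc q)
  ... | just _ = trans (+-suc _ _) (cong suc (holes+prescribed L (suc q)))
  ... | nothing = cong suc (holes+prescribed L (suc q))

  prescribed-+ : ∀ a b q → prescribed (a + b) q ≡ prescribed a q ++ prescribed b (a + q)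
  prescribed-+ zero b q = refl
  prescribed-+ (suc a) b q with τ (suc q)
  ... | just x = cong (x ∷_) (trans (prescribed-+ a b (suc q))
                                     (cong (prescribed a (suc q) ++_) (cong (prescribed b) (+-suc a q))))
  ... | nothing = trans (prescribed-+ a b (suc q))
                        (cong (prescribed a (suc q) ++_) (cong (prescribed b) (+-suc a q)))

  allowed-at : ∀ {k m x} → τ k ≡ m → Allowed m x → Allowed (τ k) x
  allowed-at {x = x} eq a = subst (λ m → Allowed m x) (sym eq) a

  fill-fits : ∀ L q p → Fits q (fill L q p)
  fill-fits zero q p = tt
  fill-fits (suc L) q p with τ (suc q) in eq
  ... | just a = allowed-at eq refl , fill-fits L (suc q) p
  fill-fits (suc L) q [] | nothing = allowed-at eq (inj₁ refl) , fill-fits L (suc q) []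
  fill-fits (suc L) q (U ∷ p) | nothing = allowed-at eq (inj₁ refl) , fill-fits L (suc q) p
  fill-fits (suc L) q (D ∷ p) | nothing = allowed-at eq (inj₂ refl) , fill-fits L (suc q) p

  length-fill : ∀ L q p → length (fill L q p) ≡ L
  length-fill zero q p = refl
  length-fill (suc L) q p with τ (suc q)
  ... | just a = cong suc (length-fill L (suc q) p)
  length-fill (suc L) q [] | nothing = cong suc (length-fill L (suc q) [])
  length-fill (suc L) q (s ∷ p) | nothing = cong suc (length-fill L (suc q) p)

  twos-fill : ∀ L q p → length p ≡ holes L q → twos (fill L q p) ≡ p
  twos-fill zero q [] e = refl
  twos-fill (suc L) q p e with τ (suc q) in eq
  ... | just a = trans (twos-one (fill L (suc q) p) (prescribed-one (suc q) a eq)) (twos-fill L (suc q) p e)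
  twos-fill (suc L) q (U ∷ p) e | nothing = cong (U ∷_) (twos-fill L (suc q) p (suc-injective e))
  twos-fill (suc L) q (D ∷ p) e | nothing = cong (D ∷_) (twos-fill L (suc q) p (suc-injective e))

  fits-fill : ∀ q w → Fits q w → w ≡ fill (length w) q (twos w)
  fits-fill q [] _ = refl
  fits-fill q (x ∷ w) (a , f) with τ (suc q) in eq
  fits-fill q (x ∷ w) (refl , f) | just _ =
    cong (x ∷_) (trans (fits-fill (suc q) w f)
                       (cong (fill (length w) (suc q)) (sym (twos-one w (prescribed-one (suc q) x eq)))))
  fits-fill q (.two ∷ w) (inj₁ refl , f) | nothing = cong (two ∷_) (fits-fill (suc q) w f)
  fits-fill q (.two̅ ∷ w) (inj₂ refl , f) | nothing = cong (two̅ ∷_) (fits-fill (suc q) w f)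

  ones-fits : ∀ q w → Fits q w → ones w ≡ prescribed (length w) q
  ones-fits q [] _ = refl
  ones-fits q (x ∷ w) (a , f) with τ (suc q) in eq
  ones-fits q (x ∷ w) (refl , f) | just _ =
    trans (ones-one w (prescribed-one (suc q) x eq)) (cong (x ∷_) (ones-fits (suc q) w f))
  ... | nothing = trans (ones-two w a) (ones-fits (suc q) w f)

  fits-take : ∀ q w k → Fits q w → Fits q (take k w)
  fits-take q w zero _ = tt
  fits-take q [] (suc k) _ = tt
  fits-take q (x ∷ w) (suc k) (a , f) = a , fits-take (suc q) w k f

  fits-at : ∀ q w → Fits q w → ∀ k x → w at k ≡ just x → Allowed (τ (q + k)) x
  fits-at q (y ∷ w) (a , f) (suc zero) x refl = subst (λ z → Allowed (τ z) y) (+-comm 1 q) a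
  fits-at q (y ∷ w) (a , f) (suc (suc k)) x e =
    subst (λ z → Allowed (τ z) x) (sym (+-suc q (suc k))) (fits-at (suc q) w f (suc k) x e)

  at-fits : ∀ q w → (∀ k x → w at k ≡ just x → Allowed (τ (q + k)) x) → Fits q w
  at-fits q [] h = tt
  at-fits q (y ∷ w) h =
    subst (λ z → Allowed (τ z) y) (+-comm q 1) (h 1 y refl) ,
    at-fits (suc q) w (λ k x e → shift k x e)
    where
    shift : ∀ k x → w at k ≡ just x → Allowed (τ (suc q + k)) x
    shift zero x e = ⊥-elim (at-zero w e)
    shift (suc k) x e = subst (λ z → Allowed (τ z) x) (+-suc q (suc k)) (h (suc (suc k)) x e)

at-range : ∀ w k {x} → w at k ≡ just x → (1 ≤ k) × (k ≤ length w)
at-range (y ∷ w) (suc zero) _ = s≤s z≤n , s≤s z≤n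
at-range (y ∷ w) (suc (suc k)) e with at-range w (suc k) e
... | _ , le = s≤s z≤n , s≤s le

at-defined : ∀ (w : List Letter) k → 1 ≤ k → k ≤ length w → ∃ λ x → w at k ≡ just x
at-defined (y ∷ w) (suc zero) _ _ = y , refl
at-defined (y ∷ w) (suc (suc k)) _ (s≤s le) = at-defined w (suc k) (s≤s z≤n) le

prescribedAt : ∀ M → (Fin M → ℕ) → (Fin M → Letter) → ℕ → Maybe Letter
prescribedAt zero P S q = nothing
prescribedAt (suc M) P S q with P fzero ≟ q
... | yes _ = just (S fzero)
... | no _ = prescribedAt M (λ i → P (fsuc i)) (λ i → S (fsuc i)) q

prescribedAt-just : ∀ M P S q a → prescribedAt M P S q ≡ just a → ∃ λ j → (P j ≡ q) × (S j ≡ a)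
prescribedAt-just (suc M) P S q a e with P fzero ≟ q
prescribedAt-just (suc M) P S q a refl | yes p = fzero , p , refl
... | no _ with prescribedAt-just M (λ i → P (fsuc i)) (λ i → S (fsuc i)) q a e
... | j , p , s = fsuc j , p , s

prescribedAt-nothing : ∀ M P S q → prescribedAt M P S q ≡ nothing → ∀ i → P i ≢ q
prescribedAt-nothing (suc M) P S q e i with P fzero ≟ q
prescribedAt-nothing (suc M) P S q () i | yes _
prescribedAt-nothing (suc M) P S q e fzero | no ¬p = ¬p
prescribedAt-nothing (suc M) P S q e (fsuc i) | no ¬p =
  prescribedAt-nothing M (λ i → P (fsuc i)) (λ i → S (fsuc i)) q e i

module Positions {M : ℕ} (S : Fin M → Letter) (oneish : ∀ i → IsOne (S i))
  (P̃ : Fin M → ℕ) (pos : ∀ i → 1 ≤ P̃ i) (sorted : ∀ i j → i Fin.< j → P̃ i < P̃ j) where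

  Slist : List Letter
  Slist = tabulate S

  letterAt : ℕ → Maybe Letter
  letterAt = prescribedAt M P̃ S

  -- Increasing positions are distinct, so each P̃ i prescribes its own S i.
  P̃-injective : ∀ i j → P̃ i ≡ P̃ j → i ≡ j
  P̃-injective i j e with FinP.<-cmp i j
  ... | tri< lt _ _ = ⊥-elim (<⇒≢ (sorted i j lt) e)
  ... | tri≈ _ eq _ = eq
  ... | tri> _ _ gt = ⊥-elim (<⇒≢ (sorted j i gt) (sym e))

  letterAt-P̃ : ∀ i → letterAt (P̃ i) ≡ just (S i)
  letterAt-P̃ i with letterAt (P̃ i) in eq
  ... | just a with prescribedAt-just M P̃ S (P̃ i) a eq
  ... | j , Pj , Sj = cong just (trans (sym Sj) (cong S (P̃-injective j i Pj)))
  letterAt-P̃ i | nothing = ⊥-elim (prescribedAt-nothing M P̃ S (P̃ i) eq i refl)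

  prescribed-one : ∀ k a → letterAt k ≡ just a → IsOne a
  prescribed-one k a e with prescribedAt-just M P̃ S k a e
  ... | j , _ , refl = oneish j

  open Template letterAt prescribed-one public

  cnt : ℕ → ℕ
  cnt zero = 0
  cnt (suc q) with letterAt (suc q)
  ... | just _ = suc (cnt q)
  ... | nothing = cnt q

  -- c counts the positions up to q: as P̃ is increasing, these are exactly
  -- the P̃ i with i < c.
  record Counts (q c : ℕ) : Set where
    field
      bounded : c ≤ M
      reached : ∀ i → P̃ i ≤ q → toℕ i < c
      passed : ∀ i → toℕ i < c → P̃ i ≤ q
  open Counts

  cnt-at : ∀ {q} → Counts q (cnt q) → ∀ j → P̃ j ≡ suc q → cnt q ≡ toℕ j
  cnt-at {q} c j e with <-cmp (cnt q) (toℕ j)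
  ... | tri≈ _ eq _ = eq
  ... | tri> _ _ gt = ⊥-elim (1+n≰n (subst (_≤ q) e (passed c j gt)))
  ... | tri< lt _ _ = ⊥-elim (<-irrefl ti (reached c i Pi≤q))
    where
    i : Fin M
    i = fromℕ< (<-trans lt (FinP.toℕ<n j))
    ti : toℕ i ≡ cnt q
    ti = FinP.toℕ-fromℕ< (<-trans lt (FinP.toℕ<n j))
    Pi≤q : P̃ i ≤ q
    Pi≤q = ≤-pred (subst (P̃ i <_) e (sorted i j (subst (_< toℕ j) (sym ti) lt)))

  count : ∀ q → Counts q (cnt q)
  count zero = record
    { bounded = z≤n
    ; reached = λ i le → ⊥-elim (1+n≰n (≤-trans (pos i) le))
    ; passed = λ i ()
    }
  count (suc q) with letterAt (suc q) in eq
  ... | just a = record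
    { bounded = subst (_< M) (sym cq) (FinP.toℕ<n j)
    ; reached = reach
    ; passed = pass
    }
    where
    c : Counts q (cnt q)
    c = count q
    j : Fin M
    j = proj₁ (prescribedAt-just M P̃ S (suc q) a eq)
    Pj : P̃ j ≡ suc q
    Pj = proj₁ (proj₂ (prescribedAt-just M P̃ S (suc q) a eq))
    cq : cnt q ≡ toℕ j
    cq = cnt-at c j Pj
    reach : ∀ i → P̃ i ≤ suc q → toℕ i < suc (cnt q)
    reach i le with P̃ i ≟ suc q
    ... | yes e = s≤s (≤-reflexive (trans (cong toℕ (P̃-injective i j (trans e (sym Pj)))) (sym cq)))
    ... | no ne = m≤n⇒m≤1+n (reached c i (≤-pred (≤∧≢⇒< le ne)))
    pass : ∀ i → toℕ i < suc (cnt q) → P̃ i ≤ suc q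
    pass i lt with m≤n⇒m<n∨m≡n (≤-pred lt)
    ... | inj₁ l = m≤n⇒m≤1+n (passed c i l)
    ... | inj₂ e = ≤-reflexive (trans (cong P̃ (FinP.toℕ-injective (trans e cq))) Pj)
  ... | nothing = record
    { bounded = bounded c
    ; reached = reach
    ; passed = λ i lt → m≤n⇒m≤1+n (passed c i lt)
    }
    where
    c : Counts q (cnt q)
    c = count q
    reach : ∀ i → P̃ i ≤ suc q → toℕ i < cnt q
    reach i le = reached c i (≤-pred (≤∧≢⇒< le (prescribedAt-nothing M P̃ S (suc q) eq i)))

  cnt≤ : ∀ q → cnt q ≤ q
  cnt≤ zero = z≤n
  cnt≤ (suc q) with letterAt (suc q)
  ... | just _ = s≤s (cnt≤ q)
  ... | nothing = m≤n⇒m≤1+n (cnt≤ q)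

  position-bound : ∀ i → suc (toℕ i) ≤ P̃ i
  position-bound i = ≤-trans (reached (count (P̃ i)) i ≤-refl) (cnt≤ (P̃ i))

  cnt-full : ∀ L → (∀ i → P̃ i ≤ L) → cnt L ≡ M
  cnt-full L all = ≤-antisym (bounded (count L)) (≮⇒≥ missing)
    where
    missing : cnt L ≮ M
    missing lt = <-irrefl (FinP.toℕ-fromℕ< lt) (reached (count L) (fromℕ< lt) (all _))

  cnt-between : ∀ i j q → toℕ j ≡ suc (toℕ i) → P̃ i ≤ q → q < P̃ j → cnt q ≡ suc (toℕ i)
  cnt-between i j q tj Piq qPj =
    ≤-antisym (subst (cnt q ≤_) tj (≮⇒≥ (λ lt → <⇒≱ qPj (passed (count q) j lt))))
              (reached (count q) i Piq)

  prescribed-prefix : ∀ q → prescribed q 0 ≡ take (cnt q) Slist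
  prescribed-prefix zero = refl
  prescribed-prefix (suc q) = begin
      prescribed (suc q) 0
    ≡⟨ cong (λ z → prescribed z 0) (+-comm 1 q) ⟩
      prescribed (q + 1) 0
    ≡⟨ prescribed-+ q 1 0 ⟩
      prescribed q 0 ++ prescribed 1 (q + 0)
    ≡⟨ cong₂ _++_ (prescribed-prefix q) (cong (prescribed 1) (+-identityʳ q)) ⟩
      take (cnt q) Slist ++ prescribed 1 q
    ≡⟨ next-letter ⟩
      take (cnt (suc q)) Slist ∎
    where
    open ≡-Reasoning
    next-letter : take (cnt q) Slist ++ prescribed 1 q ≡ take (cnt (suc q)) Slist
    next-letter with letterAt (suc q) in eq
    ... | nothing = ++-identityʳ _
    ... | just a with prescribedAt-just M P̃ S (suc q) a eq
    ... | j , Pj , refl rewrite cnt-at (count q) j Pj = sym (take-suc-tabulate S j)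

  letterAt-free : ∀ q → (∀ i → q ≢ P̃ i) → letterAt q ≡ nothing
  letterAt-free q free with letterAt q in eq
  ... | nothing = refl
  ... | just a with prescribedAt-just M P̃ S q a eq
  ... | j , Pj , _ = ⊥-elim (free j (sym Pj))

  -- The Gessel inequalities for a prefix of length q, expressed on a path p
  -- at abscissa k and with c letters of S read: Levels p (q ∸ cnt q) (cnt q).
  Levels : List Step → ℕ → ℕ → Set
  Levels p k c = (0ℤ ℤ.≤ ordinate p k) × (0ℤ ℤ.≤ ordinate p k ℤ.+ sumT (take c Slist))

  Admissible : List Step → ℕ → Set
  Admissible p q = Levels p (q ∸ cnt q) (cnt q)

  -- For a word fitting the template, the Gessel inequalities at the prefix of
  -- length q are the admissibility of its path at q: the prefix consists of
  -- the first cnt q letters of S and the first q ∸ cnt q steps of the path.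
  prefix-admissible : ∀ w → Fits 0 w → ∀ q → q ≤ length w →
                      SplitGessel (take q w) ≡ Admissible (twos w) q
  prefix-admissible w f q q≤w = cong₂ (λ h s → (0ℤ ℤ.≤ h) × (0ℤ ℤ.≤ h ℤ.+ s)) heights (cong sumT ones-q)
    where
    open ≡-Reasoning
    x : List Letter
    x = take q w
    len-x : length x ≡ q
    len-x = trans (length-take q w) (m≤n⇒m⊓n≡m q≤w)
    ones-q : ones x ≡ take (cnt q) Slist
    ones-q = begin
        ones x
      ≡⟨ ones-fits 0 x (fits-take 0 w q f) ⟩
        prescribed (length x) 0
      ≡⟨ cong (λ z → prescribed z 0) len-x ⟩
        prescribed q 0
      ≡⟨ prescribed-prefix q ⟩
        take (cnt q) Slist ∎
    steps : length (twos x) ≡ q ∸ cnt q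
    steps = sym (begin
        q ∸ cnt q
      ≡⟨ cong (_∸ cnt q) (trans (sym len-x) (length-split x)) ⟩
        length (ones x) + length (twos x) ∸ cnt q
      ≡⟨ cong (λ z → z + length (twos x) ∸ cnt q) (trans (cong length ones-q) len-prefix) ⟩
        cnt q + length (twos x) ∸ cnt q
      ≡⟨ m+n∸m≡n (cnt q) (length (twos x)) ⟩
        length (twos x) ∎)
      where
      len-prefix : length (take (cnt q) Slist) ≡ cnt q
      len-prefix = trans (length-take (cnt q) Slist)
        (m≤n⇒m⊓n≡m (subst (cnt q ≤_) (sym (length-tabulate S)) (bounded (count q))))
    heights : height (twos x) ≡ ordinate (twos w) (q ∸ cnt q)
    heights = cong height (trans (twos-take q w) (cong (λ z → take z (twos w)) steps))

  Bounded : List Step → Set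
  Bounded p = ∀ (i j : Fin M) → toℕ j ≡ suc (toℕ i) →
    ∀ (x : ℕ) → Pof P̃ i ≤ x → x ≤ Pof P̃ j → Hof S i ℤ.≤ ordinate p x

  -- Admissibility at every q up to the last position gives the (P,H)
  -- condition: abscissa x between P i and P j is reached at q = x + i + 1.
  admissible⇒bounded : ∀ L → (∀ i → P̃ i ≤ L) → ∀ p →
                       (∀ q → q ≤ L → Admissible p q) → Bounded p
  admissible⇒bounded L bnd p adm i j tj x lo hi = ⇒floor-≤ _ _ (proj₁ levels) (proj₂ levels)
    where
    q : ℕ
    q = x + suc (toℕ i)
    Piq : P̃ i ≤ q
    Piq = ≤-trans (m≤n+m∸n (P̃ i) (suc (toℕ i)))
            (≤-trans (+-monoʳ-≤ (suc (toℕ i)) lo) (≤-reflexive (+-comm (suc (toℕ i)) x)))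
    qPj : q < P̃ j
    qPj = subst (_≤ P̃ j) (trans (cong (_+_ x) (cong suc tj)) (+-suc x (suc (toℕ i))))
            (m≤o∸n⇒m+n≤o x (position-bound j) hi)
    cq : cnt q ≡ suc (toℕ i)
    cq = cnt-between i j q tj Piq qPj
    abscissa : q ∸ cnt q ≡ x
    abscissa = trans (cong (q ∸_) cq) (m+n∸n≡m x (suc (toℕ i)))
    levels : Levels p x (suc (toℕ i))
    levels = subst₂ (Levels p) abscissa cq (adm q (≤-trans (<⇒≤ qPj) (bnd j)))

  -- Conversely a nonnegative path satisfying the (P,H) condition is admissible
  -- everywhere, provided S is balanced: between P̃ i and P̃ (i+1) the bound
  -- H i is the second Gessel inequality, before P̃ 0 and after the last
  -- position the 1-letters read so far have net count 0.
  bounded⇒admissible : sumT Slist ≡ 0ℤ → ∀ p → NonNeg p → Bounded p → ∀ q → Admissible p q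
  bounded⇒admissible balanced p nonneg ph q = h≥0 , second (cnt q) refl
    where
    k : ℕ
    k = q ∸ cnt q
    h : ℤ
    h = ordinate p k
    h≥0 : 0ℤ ℤ.≤ h
    h≥0 = nonneg-ordinate p nonneg k
    second : ∀ c → cnt q ≡ c → 0ℤ ℤ.≤ h ℤ.+ sumT (take c Slist)
    second zero _ = subst (0ℤ ℤ.≤_) (sym (ℤP.+-identityʳ h)) h≥0
    second (suc c) ec with m≤n⇒m<n∨m≡n (subst (_≤ M) ec (bounded (count q)))
    ... | inj₂ all-read = subst (λ z → 0ℤ ℤ.≤ h ℤ.+ z) (sym whole) (subst (0ℤ ℤ.≤_) (sym (ℤP.+-identityʳ h)) h≥0)
      where
      whole : sumT (take (suc c) Slist) ≡ 0ℤ
      whole = trans (cong (λ z → sumT (take z Slist)) all-read)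
                    (trans (cong sumT (take-all M Slist (≤-reflexive (length-tabulate S)))) balanced)
    ... | inj₁ lt = subst (λ z → 0ℤ ℤ.≤ h ℤ.+ sumT (take (suc z) Slist)) ti (proj₂ (floor-≤⇒ h _ Hi≤h))
      where
      c<M : c < M
      c<M = <-trans (n<1+n c) lt
      i j : Fin M
      i = fromℕ< c<M
      j = fromℕ< lt
      ti : toℕ i ≡ c
      ti = FinP.toℕ-fromℕ< c<M
      tj : toℕ j ≡ suc c
      tj = FinP.toℕ-fromℕ< lt
      Piq : P̃ i ≤ q
      Piq = passed (count q) i (subst₂ _<_ (sym ti) (sym ec) (n<1+n c))
      qPj : q < P̃ j
      qPj = ≰⇒> (λ le → <-irrefl refl (subst₂ _<_ tj ec (reached (count q) j le)))
      lo : Pof P̃ i ≤ k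
      lo = subst₂ (λ a b → P̃ i ∸ suc a ≤ q ∸ b) (sym ti) (sym ec) (∸-monoˡ-≤ (suc c) Piq)
      hi : k ≤ Pof P̃ j
      hi = subst₂ (λ a b → q ∸ b ≤ P̃ j ∸ suc a) (sym tj) (sym ec) (∸-monoˡ-≤ (suc (suc c)) qPj)
      Hi≤h : Hof S i ℤ.≤ h
      Hi≤h = ph i j (trans tj (cong suc (sym ti))) k lo hi

module Construction (M n₂ n : ℕ) (length-eq : 2 * n ≡ M + 2 * n₂)
  (S : Fin M → Letter) (oneish : ∀ i → IsOne (S i)) (balanced : sumT (tabulate S) ≡ 0ℤ)
  (P̃ : Fin M → ℕ) (pos : ∀ i → 1 ≤ P̃ i) (sorted : ∀ i j → i Fin.< j → P̃ i < P̃ j)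
  (bnd : ∀ i → P̃ i ≤ 2 * n) where

  open Positions S oneish P̃ pos sorted

  L : ℕ
  L = 2 * n

  Word : Set
  Word = Σ (List Letter) (IsConstrainedWord n S P̃)

  Path : Set
  Path = Σ (List Step) (IsPHDyck n₂ M (Pof P̃) (Hof S))

  constrained⇒fits : ∀ w → IsConstrainedWord n S P̃ w → Fits 0 w
  constrained⇒fits w (len , _ , atS , atT) = at-fits 0 w allowed
    where
    allowed : ∀ k x → w at k ≡ just x → Allowed (letterAt k) x
    allowed k x e with letterAt k in eq
    ... | just a with prescribedAt-just M P̃ S k a eq
    ... | j , refl , refl = just-injective (trans (sym e) (atS j))
    allowed k x e | nothing with at-range w k e
    ... | k≥1 , k≤w with atT k k≥1 (subst (k ≤_) len k≤w) (λ i k≡ → prescribedAt-nothing M P̃ S k eq i (sym k≡))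
    ... | inj₁ e₂ = inj₁ (just-injective (trans (sym e) e₂))
    ... | inj₂ e₂ = inj₂ (just-injective (trans (sym e) e₂))

  prescribed-full : prescribed L 0 ≡ Slist
  prescribed-full = begin
      prescribed L 0
    ≡⟨ prescribed-prefix L ⟩
      take (cnt L) Slist
    ≡⟨ cong (λ z → take z Slist) (cnt-full L bnd) ⟩
      take M Slist
    ≡⟨ take-all M Slist (≤-reflexive (length-tabulate S)) ⟩
      Slist ∎
    where open ≡-Reasoning

  ones-full : ∀ w → Fits 0 w → length w ≡ L → ones w ≡ Slist
  ones-full w f len = trans (ones-fits 0 w f) (trans (cong (λ z → prescribed z 0) len) prescribed-full)

  free-positions : holes L 0 ≡ 2 * n₂
  free-positions = +-cancelʳ-≡ M (holes L 0) (2 * n₂) (begin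
      holes L 0 + M
    ≡⟨ cong (_+_ (holes L 0)) (sym (trans (cong length prescribed-full) (length-tabulate S))) ⟩
      holes L 0 + length (prescribed L 0)
    ≡⟨ holes+prescribed L 0 ⟩
      L
    ≡⟨ trans length-eq (+-comm M (2 * n₂)) ⟩
      2 * n₂ + M ∎)
    where open ≡-Reasoning

  word⇒path : ∀ w → IsConstrainedWord n S P̃ w → IsPHDyck n₂ M (Pof P̃) (Hof S) (twos w)
  word⇒path w c@(len , (gessel , _ , N₂≡N₂̄) , _) = (length-path , nonneg , returns) , bounded
    where
    f : Fits 0 w
    f = constrained⇒fits w c
    split : ∀ q → SplitGessel (take q w)
    split = gessel⇒split w gessel
    length-path : length (twos w) ≡ 2 * n₂
    length-path = +-cancelˡ-≡ M (length (twos w)) (2 * n₂) (begin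
        M + length (twos w)
      ≡⟨ cong (_+ length (twos w)) (sym (trans (cong length (ones-full w f len)) (length-tabulate S))) ⟩
        length (ones w) + length (twos w)
      ≡⟨ sym (length-split w) ⟩
        length w
      ≡⟨ trans len length-eq ⟩
        M + 2 * n₂ ∎)
      where open ≡-Reasoning
    nonneg : NonNeg (twos w)
    nonneg = split⇒nonneg w split
    returns : height (twos w) ≡ 0ℤ
    returns = trans (sym (height-twos w))
      (trans (cong (λ z → (+ z) ℤ.- (+ N two̅ w)) N₂≡N₂̄) (ℤP.+-inverseʳ (+ N two̅ w)))
    bounded : Bounded (twos w)
    bounded = admissible⇒bounded L bnd (twos w)
      (λ q q≤L → subst (λ A → A) (prefix-admissible w f q (subst (q ≤_) (sym len) q≤L)) (split q))

  module Filled (p : List Step) (php : IsPHDyck n₂ M (Pof P̃) (Hof S) p) where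
    w : List Letter
    w = fill L 0 p

    fits : Fits 0 w
    fits = fill-fits L 0 p

    len : length w ≡ L
    len = length-fill L 0 p

    path : twos w ≡ p
    path = twos-fill L 0 p (trans (proj₁ (proj₁ php)) (sym free-positions))

    gessel : IsGessel w
    gessel = split⇒gessel w (λ q q≤w → subst (λ A → A) (sym (prefix-admissible w fits q q≤w))
      (subst (λ z → Admissible z q) (sym path)
        (bounded⇒admissible balanced p (proj₁ (proj₂ (proj₁ php))) (proj₂ php) q)))

    N₁≡N₁̄ : N one w ≡ N one̅ w
    N₁≡N₁̄ = counts-equal _ _ (trans (sumT-ones w) (trans (cong sumT (ones-full w fits len)) balanced))

    N₂≡N₂̄ : N two w ≡ N two̅ w
    N₂≡N₂̄ = counts-equal _ _ (trans (height-twos w) (trans (cong height path) (proj₂ (proj₂ (proj₁ php)))))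

    letter : ∀ q → 1 ≤ q → q ≤ L → ∃ λ x → (w at q ≡ just x) × Allowed (letterAt q) x
    letter q q≥1 q≤L with at-defined w q q≥1 (subst (q ≤_) (sym len) q≤L)
    ... | x , e = x , e , fits-at 0 w fits q x e

    prescribed-letters : ∀ i → w at (P̃ i) ≡ just (S i)
    prescribed-letters i with letter (P̃ i) (pos i) (bnd i)
    ... | x , e , a = trans e (cong just (subst (λ m → Allowed m x) (letterAt-P̃ i) a))

    free-letters : ∀ q → 1 ≤ q → q ≤ L → (∀ i → q ≢ P̃ i) → (w at q ≡ just two) ⊎ (w at q ≡ just two̅)
    free-letters q q≥1 q≤L free with letter q q≥1 q≤L
    ... | x , e , a with subst (λ m → Allowed m x) (letterAt-free q free) a
    ... | inj₁ refl = inj₁ e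
    ... | inj₂ refl = inj₂ e

    constrained : IsConstrainedWord n S P̃ w
    constrained = len , (gessel , N₁≡N₁̄ , N₂≡N₂̄) , prescribed-letters , free-letters

  -- w ↦ twos w is injective because a fitting word is the filling of its own
  -- path, and surjective by the backward direction.
  bijection : Bijection (SubSetoid (List Letter) (IsConstrainedWord n S P̃))
                        (SubSetoid (List Step) (IsPHDyck n₂ M (Pof P̃) (Hof S)))
  bijection = record
    { to = to
    ; cong = λ {x} {y} → to-cong {x} {y}
    ; bijective = (λ {x} {y} → injective {x} {y}) , surjective
    }
    where
    to : Word → Path
    to (w , c) = twos w , word⇒path w c
    to-cong : ∀ {x y : Word} → proj₁ x ≡ proj₁ y → twos (proj₁ x) ≡ twos (proj₁ y)
    to-cong = cong twos
    injective : ∀ {x y : Word} → twos (proj₁ x) ≡ twos (proj₁ y) → proj₁ x ≡ proj₁ y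
    injective {w , c} {w′ , c′} e = begin
        w
      ≡⟨ fits-fill 0 w (constrained⇒fits w c) ⟩
        fill (length w) 0 (twos w)
      ≡⟨ cong₂ (λ l p → fill l 0 p) (trans (proj₁ c) (sym (proj₁ c′))) e ⟩
        fill (length w′) 0 (twos w′)
      ≡⟨ sym (fits-fill 0 w′ (constrained⇒fits w′ c′)) ⟩
        w′ ∎
      where open ≡-Reasoning
    surjective : ∀ (y : Path) → ∃ λ (x : Word) → ∀ {z : Word} → proj₁ z ≡ proj₁ x → twos (proj₁ z) ≡ proj₁ y
    surjective (p , php) = (Filled.w p php , Filled.constrained p php) , λ e → trans (cong twos e) (Filled.path p php)

lemma3p2 : (n₁ n₂ : ℕ) (S : Fin (2 * n₁) → Letter) →
    (∀ i → (S i ≡ one) ⊎ (S i ≡ one̅)) →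
    N one (tabulate S) ≡ n₁ → N one̅ (tabulate S) ≡ n₁ →
    (P̃ : Fin (2 * n₁) → ℕ) →
    (∀ i → 1 ≤ P̃ i) → (∀ i j → i Fin.< j → P̃ i < P̃ j) → (∀ i → P̃ i ≤ 2 * (n₁ + n₂)) →
    Bijection (SubSetoid (List Letter) (IsConstrainedWord (n₁ + n₂) S P̃))
              (SubSetoid (List Step) (IsPHDyck n₂ (2 * n₁) (Pof P̃) (Hof S)))
lemma3p2 n₁ n₂ S oneish N₁≡n₁ N₁̄≡n₁ P̃ pos sorted bnd =
  Construction.bijection (2 * n₁) n₂ (n₁ + n₂) (*-distribˡ-+ 2 n₁ n₂) S oneish balanced P̃ pos sorted bnd
  where
  balanced : sumT (tabulate S) ≡ 0ℤ
  balanced = begin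
      sumT (tabulate S)
    ≡⟨ cong sumT (sym (ones-of-ones (tabulate⁺ oneish))) ⟩
      sumT (ones (tabulate S))
    ≡⟨ sym (sumT-ones (tabulate S)) ⟩
      (+ N one (tabulate S)) ℤ.- (+ N one̅ (tabulate S))
    ≡⟨ cong₂ (λ a b → (+ a) ℤ.- (+ b)) N₁≡n₁ N₁̄≡n₁ ⟩
      (+ n₁) ℤ.- (+ n₁)
    ≡⟨ ℤP.+-inverseʳ (+ n₁) ⟩
      0ℤ ∎
    where open ≡-Reasoning
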